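{- Let $i \ge 0$ be an integer and let $n$ be an integer with $0<n<2^i$. Then $$f(n,i) = c(2^i-n).$$
   Context: For an integer $n$ and an integer $i\ge 0$, $f(n,i)$ denotes the number of binary signed-digit (BSD) representations of $n$ on $i$ bits, i.e. the number of tuples $(b_{i-1},\dots,b_0)\in\{1,0,-1\}^i$ with $n=\sum_{j=0}^{i-1} b_j 2^j$. Stern's diatomic sequence $c$ is defined on non-negative integers by $c(0)=0$, $c(1)=1$, $c(2m)=c(m)$, and $c(2m+1)=c(m)+c(m+1)$. -}

module Defs where

open import Data.Nat using (ℕ; zero; suc; _+_; _*_; _^_)
open import Data.Nat.DivMod using (_/_; _%_)
open import Data.Integer as ℤ using (ℤ; +_; -[1+_])
open import Data.List using (List; []; _∷_; length; filter; map; concatMap)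
open import Data.Vec using (Vec; []; _∷_)
open import Relation.Nullary.Decidable using (Dec)

data Digit : Set where
  one zero' minusOne : Digit

digitValue : Digit → ℤ
digitValue one      = + 1
digitValue zero'    = + 0
digitValue minusOne = -[1+ 0 ]

-- value of (b_{i-1}, ..., b_0): the vector is stored least significant first,
-- i.e. the head of the vector is b_0.  value = Σ_j b_j 2^j
value : ∀ {i} → Vec Digit i → ℤ
value []       = + 0
value (b ∷ bs) = digitValue b ℤ.+ (+ 2) ℤ.* value bs

allTuples : (i : ℕ) → List (Vec Digit i)
allTuples zero    = [] ∷ []
allTuples (suc i) =
  concatMap (λ bs → (one ∷ bs) ∷ (zero' ∷ bs) ∷ (minusOne ∷ bs) ∷ []) (allTuples i)

f : ℤ → ℕ → ℕ
f n i = length (filter (λ bs → value bs ℤ.≟ n) (allTuples i))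

-- Stern's diatomic sequence, c(0)=0, c(1)=1, c(2m)=c(m), c(2m+1)=c(m)+c(m+1),
-- computed with fuel (fuel suc n suffices for argument n).
cFuel : ℕ → ℕ → ℕ
cFuel zero    _ = 0
cFuel (suc k) zero = 0
cFuel (suc k) (suc zero) = 1
cFuel (suc k) n@(suc (suc _)) with n % 2
... | zero  = cFuel k (n / 2)
... | suc _ = cFuel k (n / 2) + cFuel k (n / 2 + 1)

c : ℕ → ℕ
c n = cFuel (suc n) n

-- Reading off the lowest digit b₀ of a representation gives f(2m, i+1) = f(m, i), since b₀
-- must be 0, and f(2m+1, i+1) = f(m, i) + f(m+1, i), according as b₀ = 1 or b₀ = -1.
-- Measured from the other end, n = 2^i - k, these are exactly Stern's recurrences
-- c(2k) = c(k) and c(2k+1) = c(k) + c(k+1), so induction on i proves f(m, i) = c(2^i - m)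
-- for every 0 ≤ m ≤ 2^i.

module Submission where

open import Defs
open import Data.Nat using (ℕ; _^_; _∸_)
open import Data.Integer using (ℤ; +_; _<_; _-_)
open import Data.Integer using (∣_∣)
open import Relation.Binary.PropositionalEquality using (_≡_)

open import Algebra.Bundles using (AbelianGroup)
import Algebra.Properties.CommutativeSemigroup as CommSemigroupProperties
import Algebra.Properties.Group as GroupProperties
open import Data.Integer as ℤ using (-[1+_])
import Data.Integer.Properties as ℤ
open import Data.Integer.Tactic.RingSolver using (solve-∀)
open import Data.List using (List; []; _∷_; [_]; _++_; length; filter; concatMap)
open import Data.List.Properties using (length-++; filter-++; filter-reject)
open import Data.Nat as ℕ using (zero; suc; _+_; _*_; _≤_; z≤n; s≤s; _/_; _%_)
open import Data.Nat.DivMod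
open import Data.Nat.Divisibility using (m∣m*n)
open import Data.Nat.Properties
open import Data.Vec using (Vec; _∷_)
open import Function using (_∘_)
open import Relation.Binary.PropositionalEquality
  using (_≢_; refl; sym; trans; cong; cong₂; subst; module ≡-Reasoning)
open import Relation.Nullary using (¬_; yes; no; contradiction)
open import Relation.Unary using (Pred; Decidable)

open CommSemigroupProperties +-commutativeSemigroup using (interchange)
open GroupProperties (AbelianGroup.group ℤ.+-0-abelianGroup) using (∙-cancelˡ)

count : ∀ {a p} {A : Set a} {P : Pred A p} → Decidable P → List A → ℕ
count P? xs = length (filter P? xs)

module _ {a p} {A : Set a} {P : Pred A p} (P? : Decidable P) where

  count-++ : ∀ xs ys → count P? (xs ++ ys) ≡ count P? xs + count P? ys
  count-++ xs ys = trans (cong length (filter-++ P? xs ys)) (length-++ (filter P? xs))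

  count-reject : ∀ {x} → ¬ P x → count P? [ x ] ≡ 0
  count-reject ¬Px = cong length (filter-reject P? ¬Px)

module _ {a b p q} {A : Set a} {B : Set b} {P : Pred A p} {Q : Pred B q}
         (P? : Decidable P) (Q? : Decidable Q) where

  count-[]-⇔ : ∀ {x y} → (P x → Q y) → (Q y → P x) → count P? [ x ] ≡ count Q? [ y ]
  count-[]-⇔ {x} {y} P⇒Q Q⇒P with P? x | Q? y
  ... | yes _  | yes _  = refl
  ... | no  _  | no  _  = refl
  ... | yes Px | no ¬Qy = contradiction (P⇒Q Px) ¬Qy
  ... | no ¬Px | yes Qy = contradiction (Q⇒P Qy) ¬Px

  count-concatMap : ∀ (g : B → List A) → (∀ x → count P? (g x) ≡ count Q? [ x ]) →
                    ∀ xs → count P? (concatMap g xs) ≡ count Q? xs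
  count-concatMap g hyp []       = refl
  count-concatMap g hyp (x ∷ xs) = begin
    count P? (g x ++ concatMap g xs)          ≡⟨ count-++ P? (g x) _ ⟩
    count P? (g x) + count P? (concatMap g xs) ≡⟨ cong₂ _+_ (hyp x) (count-concatMap g hyp xs) ⟩
    count Q? [ x ] + count Q? xs               ≡⟨ count-++ Q? [ x ] xs ⟨
    count Q? (x ∷ xs)                          ∎
    where open ≡-Reasoning

module _ {a b p q r} {A : Set a} {B : Set b} {P : Pred A p} {Q : Pred B q} {R : Pred B r}
         (P? : Decidable P) (Q? : Decidable Q) (R? : Decidable R) where

  count-concatMap-+ : ∀ (g : B → List A) →
                      (∀ x → count P? (g x) ≡ count Q? [ x ] + count R? [ x ]) →
                      ∀ xs → count P? (concatMap g xs) ≡ count Q? xs + count R? xs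
  count-concatMap-+ g hyp []       = refl
  count-concatMap-+ g hyp (x ∷ xs) = begin
    count P? (g x ++ concatMap g xs)
      ≡⟨ count-++ P? (g x) _ ⟩
    count P? (g x) + count P? (concatMap g xs)
      ≡⟨ cong₂ _+_ (hyp x) (count-concatMap-+ g hyp xs) ⟩
    (count Q? [ x ] + count R? [ x ]) + (count Q? xs + count R? xs)
      ≡⟨ interchange (count Q? [ x ]) (count R? [ x ]) (count Q? xs) (count R? xs) ⟩
    (count Q? [ x ] + count Q? xs) + (count R? [ x ] + count R? xs)
      ≡⟨ cong₂ _+_ (count-++ Q? [ x ] xs) (count-++ R? [ x ] xs) ⟨
    count Q? (x ∷ xs) + count R? (x ∷ xs)
      ∎
    where open ≡-Reasoning

+-double-cancelˡ : ∀ r x y → r ℤ.+ + 2 ℤ.* x ≡ r ℤ.+ + 2 ℤ.* y → x ≡ y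
+-double-cancelˡ r x y eq = ℤ.*-cancelˡ-≡ (+ 2) x y (∙-cancelˡ r _ _ eq)

odd≢even : ∀ x y → + 1 ℤ.+ + 2 ℤ.* x ≢ + 2 ℤ.* y
odd≢even x y eq = contradiction (m*n≡1⇒m≡1 2 ∣ y - x ∣ 2∣y-x∣≡1) λ ()
  where
  open ≡-Reasoning
  2∣y-x∣≡1 : 2 * ∣ y - x ∣ ≡ 1
  2∣y-x∣≡1 = begin
    2 * ∣ y - x ∣                              ≡⟨ ℤ.abs-* (+ 2) (y - x) ⟨
    ∣ + 2 ℤ.* (y - x) ∣                        ≡⟨ cong ∣_∣ (distrib y x) ⟩
    ∣ + 2 ℤ.* y - + 2 ℤ.* x ∣                  ≡⟨ cong (λ z → ∣ z - + 2 ℤ.* x ∣) eq ⟨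
    ∣ + 1 ℤ.+ + 2 ℤ.* x - + 2 ℤ.* x ∣          ≡⟨ cong ∣_∣ (cancel x) ⟩
    1                                          ∎
    where
    distrib : ∀ y x → + 2 ℤ.* (y - x) ≡ + 2 ℤ.* y - + 2 ℤ.* x
    distrib = solve-∀
    cancel : ∀ x → + 1 ℤ.+ + 2 ℤ.* x - + 2 ℤ.* x ≡ + 1
    cancel = solve-∀

represents? : ∀ {i} (n : ℤ) → Decidable (λ (bs : Vec Digit i) → value bs ≡ n)
represents? n bs = value bs ℤ.≟ n

-- allTuples (suc i) unfolds to concatMap extensions (allTuples i).
extensions : ∀ {i} → Vec Digit i → List (Vec Digit (suc i))
extensions bs = (one ∷ bs) ∷ (zero' ∷ bs) ∷ (minusOne ∷ bs) ∷ []

module Extensions {i} (n : ℤ) (bs : Vec Digit i) where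

  count-digit : Digit → ℕ
  count-digit d = count (represents? n) [ d ∷ bs ]

  count-extensions : count (represents? n) (extensions bs) ≡
                     count-digit one + (count-digit zero' + count-digit minusOne)
  count-extensions = trans (count-++ (represents? n) [ one ∷ bs ] _)
    (cong (λ k → count-digit one + k) (count-++ (represents? n) [ zero' ∷ bs ] [ minusOne ∷ bs ]))

  count-digit-match : ∀ d m → n ≡ digitValue d ℤ.+ + 2 ℤ.* m →
                      count-digit d ≡ count (represents? m) [ bs ]
  count-digit-match d m n≡ = count-[]-⇔ (represents? n) (represents? m) {d ∷ bs} {bs}
    (λ eq → +-double-cancelˡ (digitValue d) (value bs) m (trans eq n≡))
    (λ eq → trans (cong (λ v → digitValue d ℤ.+ + 2 ℤ.* v) eq) (sym n≡))

  count-digit-mismatch : ∀ d → value (d ∷ bs) ≢ n → count-digit d ≡ 0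
  count-digit-mismatch d = count-reject (represents? n) {d ∷ bs}

minusOne-odd : ∀ v → -[1+ 0 ] ℤ.+ + 2 ℤ.* v ≡ + 1 ℤ.+ + 2 ℤ.* (v - + 1)
minusOne-odd = solve-∀

odd-via-minusOne : ∀ m → + 1 ℤ.+ + 2 ℤ.* m ≡ -[1+ 0 ] ℤ.+ + 2 ℤ.* (+ 1 ℤ.+ m)
odd-via-minusOne = solve-∀

f-double : ∀ i m → f (+ 2 ℤ.* m) (suc i) ≡ f m i
f-double i m =
  count-concatMap (represents? (+ 2 ℤ.* m)) (represents? m) extensions split (allTuples i)
  where
  split : ∀ bs → count (represents? (+ 2 ℤ.* m)) (extensions bs) ≡ count (represents? m) [ bs ]
  split bs = begin
    count (represents? (+ 2 ℤ.* m)) (extensions bs)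
      ≡⟨ count-extensions ⟩
    count-digit one + (count-digit zero' + count-digit minusOne)
      ≡⟨ cong₂ (λ x y → x + (count-digit zero' + y))
           (count-digit-mismatch one (odd≢even (value bs) m))
           (count-digit-mismatch minusOne (odd≢even (value bs - + 1) m ∘ trans (sym (minusOne-odd (value bs))))) ⟩
    count-digit zero' + 0
      ≡⟨ cong (_+ 0) (count-digit-match zero' m (sym (ℤ.+-identityˡ _))) ⟩
    count (represents? m) [ bs ] + 0
      ≡⟨ +-identityʳ _ ⟩
    count (represents? m) [ bs ]
      ∎
    where
    open ≡-Reasoning
    open Extensions (+ 2 ℤ.* m) bs

f-double+1 : ∀ i m → f (+ 1 ℤ.+ + 2 ℤ.* m) (suc i) ≡ f m i + f (+ 1 ℤ.+ m) i
f-double+1 i m =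
  count-concatMap-+ (represents? (+ 1 ℤ.+ + 2 ℤ.* m)) (represents? m) (represents? (+ 1 ℤ.+ m))
                    extensions split (allTuples i)
  where
  split : ∀ bs → count (represents? (+ 1 ℤ.+ + 2 ℤ.* m)) (extensions bs) ≡
                 count (represents? m) [ bs ] + count (represents? (+ 1 ℤ.+ m)) [ bs ]
  split bs = begin
    count (represents? (+ 1 ℤ.+ + 2 ℤ.* m)) (extensions bs)
      ≡⟨ count-extensions ⟩
    count-digit one + (count-digit zero' + count-digit minusOne)
      ≡⟨ cong₂ (λ x y → x + (count-digit zero' + y))
           (count-digit-match one m refl)
           (count-digit-match minusOne (+ 1 ℤ.+ m) (odd-via-minusOne m)) ⟩
    count (represents? m) [ bs ] + (count-digit zero' + count (represents? (+ 1 ℤ.+ m)) [ bs ])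
      ≡⟨ cong (λ x → count (represents? m) [ bs ] + (x + count (represents? (+ 1 ℤ.+ m)) [ bs ]))
           (count-digit-mismatch zero' λ eq → odd≢even m (value bs) (trans (sym eq) (ℤ.+-identityˡ _))) ⟩
    count (represents? m) [ bs ] + count (represents? (+ 1 ℤ.+ m)) [ bs ]
      ∎
    where
    open ≡-Reasoning
    open Extensions (+ 1 ℤ.+ + 2 ℤ.* m) bs

2*m/2≡m : ∀ m → 2 * m / 2 ≡ m
2*m/2≡m m = trans (cong (_/ 2) (*-comm 2 m)) (m*n/n≡m m 2)

[1+2*m]/2≡m : ∀ m → (1 + 2 * m) / 2 ≡ m
[1+2*m]/2≡m m = trans (+-distrib-/-∣ʳ 1 {d = 2} (m∣m*n m)) (2*m/2≡m m)

2*m%2≡0 : ∀ m → 2 * m % 2 ≡ 0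
2*m%2≡0 m = trans (cong (_% 2) (*-comm 2 m)) (m*n%n≡0 m 2)

[1+2*m]%2≡1 : ∀ m → (1 + 2 * m) % 2 ≡ 1
[1+2*m]%2≡1 m = trans (cong (λ k → (1 + k) % 2) (*-comm 2 m)) ([m+kn]%n≡m%n 1 m 2)

[2+m]/2≡1+m/2 : ∀ m → (2 + m) / 2 ≡ 1 + m / 2
[2+m]/2≡1+m/2 m = m/n≡1+[m∸n]/n {2 + m} {2} (s≤s (s≤s z≤n))

cFuel-even : ∀ K m → m % 2 ≡ 0 → cFuel (suc K) (2 + m) ≡ cFuel K ((2 + m) / 2)
cFuel-even K m eq with m % 2 | eq
... | zero | _ = refl

cFuel-odd : ∀ K m {r} → m % 2 ≡ suc r →
            cFuel (suc K) (2 + m) ≡ cFuel K ((2 + m) / 2) + cFuel K ((2 + m) / 2 + 1)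
cFuel-odd K m eq with m % 2 | eq
... | suc _ | _ = refl

[2+m]/2<2+m : ∀ m → (2 + m) / 2 ℕ.< 2 + m
[2+m]/2<2+m m = m/n<m (2 + m) 2 (s≤s (s≤s z≤n))

-- The odd-parity hypothesis only serves to exclude m = 0.
[2+m]/2+1<2+m : ∀ m {r} → m % 2 ≡ suc r → (2 + m) / 2 + 1 ℕ.< 2 + m
[2+m]/2+1<2+m (suc m) _ = begin-strict
  (2 + suc m) / 2 + 1  ≡⟨ cong (_+ 1) ([2+m]/2≡1+m/2 (suc m)) ⟩
  1 + suc m / 2 + 1    ≡⟨ +-comm (1 + suc m / 2) 1 ⟩
  2 + suc m / 2        <⟨ +-monoʳ-< 2 (m/n<m (suc m) 2 (s≤s (s≤s z≤n))) ⟩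
  2 + suc m            ∎
  where open ≤-Reasoning

cFuel-agree : ∀ n {K L} → n ℕ.< K → n ℕ.< L → cFuel K n ≡ cFuel L n
cFuel-agree zero          {suc K} {suc L} _ _ = refl
cFuel-agree (suc zero)    {suc K} {suc L} _ _ = refl
cFuel-agree (suc (suc m)) {suc K} {suc L} (s≤s n≤K) (s≤s n≤L) with m % 2 in parity
... | zero  = cFuel-agree _ (<-≤-trans ([2+m]/2<2+m m) n≤K) (<-≤-trans ([2+m]/2<2+m m) n≤L)
... | suc _ = cong₂ _+_
  (cFuel-agree _ (<-≤-trans ([2+m]/2<2+m m) n≤K) (<-≤-trans ([2+m]/2<2+m m) n≤L))
  (cFuel-agree _ (<-≤-trans ([2+m]/2+1<2+m m parity) n≤K) (<-≤-trans ([2+m]/2+1<2+m m parity) n≤L))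

cFuel≡c : ∀ n {K} → n ℕ.< K → cFuel K n ≡ c n
cFuel≡c n n<K = cFuel-agree n n<K ≤-refl

c-unfold-even : ∀ m → m % 2 ≡ 0 → c (2 + m) ≡ c ((2 + m) / 2)
c-unfold-even m even = trans (cFuel-even (2 + m) m even) (cFuel≡c _ ([2+m]/2<2+m m))

c-unfold-odd : ∀ m {r} → m % 2 ≡ suc r → c (2 + m) ≡ c ((2 + m) / 2) + c ((2 + m) / 2 + 1)
c-unfold-odd m odd = trans (cFuel-odd (2 + m) m odd)
  (cong₂ _+_ (cFuel≡c _ ([2+m]/2<2+m m)) (cFuel≡c _ ([2+m]/2+1<2+m m odd)))

c-double : ∀ k → c (2 * k) ≡ c k
c-double zero    = refl
c-double (suc k) = begin
  c (2 * suc k)        ≡⟨ cong c (*-suc 2 k) ⟩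
  c (2 + 2 * k)        ≡⟨ c-unfold-even (2 * k) (2*m%2≡0 k) ⟩
  c ((2 + 2 * k) / 2)  ≡⟨ cong c (trans ([2+m]/2≡1+m/2 (2 * k)) (cong suc (2*m/2≡m k))) ⟩
  c (suc k)            ∎
  where open ≡-Reasoning

c-double+1 : ∀ k → c (1 + 2 * k) ≡ c k + c (1 + k)
c-double+1 zero    = refl
c-double+1 (suc k) = begin
  c (1 + 2 * suc k)                              ≡⟨ cong (c ∘ suc) (*-suc 2 k) ⟩
  c (2 + (1 + 2 * k))                            ≡⟨ c-unfold-odd (1 + 2 * k) ([1+2*m]%2≡1 k) ⟩
  c ((2 + (1 + 2 * k)) / 2) + c ((2 + (1 + 2 * k)) / 2 + 1)
    ≡⟨ cong (λ h → c h + c (h + 1)) (trans ([2+m]/2≡1+m/2 (1 + 2 * k)) (cong suc ([1+2*m]/2≡m k))) ⟩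
  c (suc k) + c (suc k + 1)                      ≡⟨ cong (λ h → c (suc k) + c h) (+-comm (suc k) 1) ⟩
  c (suc k) + c (2 + k)                          ∎
  where open ≡-Reasoning

2*a∸[1+2*q]≡1+2*[a∸[1+q]] : ∀ {a q} → q ℕ.< a → 2 * a ∸ (1 + 2 * q) ≡ 1 + 2 * (a ∸ suc q)
2*a∸[1+2*q]≡1+2*[a∸[1+q]] {a} {q} q<a = begin
  (1 + 2 * a) ∸ (2 + 2 * q)  ≡⟨ +-∸-assoc 1 2+2*q≤2*a ⟩
  1 + (2 * a ∸ (2 + 2 * q))  ≡⟨ cong (λ x → 1 + (2 * a ∸ x)) (*-suc 2 q) ⟨
  1 + (2 * a ∸ 2 * suc q)    ≡⟨ cong suc (*-distribˡ-∸ 2 a (suc q)) ⟨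
  1 + 2 * (a ∸ suc q)        ∎
  where
  open ≡-Reasoning
  2+2*q≤2*a : 2 + 2 * q ≤ 2 * a
  2+2*q≤2*a = subst (_≤ 2 * a) (*-suc 2 q) (*-monoʳ-≤ 2 q<a)

data EvenOdd : ℕ → Set where
  even : ∀ q → EvenOdd (2 * q)
  odd  : ∀ q → EvenOdd (1 + 2 * q)

evenOdd : ∀ m → EvenOdd m
evenOdd zero = even 0
evenOdd (suc m) with evenOdd m
... | even q = odd q
... | odd q  = subst EvenOdd (*-suc 2 q) (even (suc q))

f≡c[2^i∸m] : ∀ i m → m ≤ 2 ^ i → f (+ m) i ≡ c (2 ^ i ∸ m)
f≡c[2^i∸m] zero    zero       _  = refl
f≡c[2^i∸m] zero    (suc zero) _  = refl
f≡c[2^i∸m] zero    (suc (suc m)) (s≤s ())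
f≡c[2^i∸m] (suc i) m          m≤ with evenOdd m
... | even q = begin
  f (+ (2 * q)) (suc i)     ≡⟨ cong (λ n → f n (suc i)) (ℤ.pos-* 2 q) ⟩
  f (+ 2 ℤ.* + q) (suc i)   ≡⟨ f-double i (+ q) ⟩
  f (+ q) i                 ≡⟨ f≡c[2^i∸m] i q (*-cancelˡ-≤ 2 m≤) ⟩
  c (2 ^ i ∸ q)             ≡⟨ c-double (2 ^ i ∸ q) ⟨
  c (2 * (2 ^ i ∸ q))       ≡⟨ cong c (*-distribˡ-∸ 2 (2 ^ i) q) ⟩
  c (2 ^ suc i ∸ 2 * q)     ∎
  where open ≡-Reasoning
... | odd q = begin
  f (+ (1 + 2 * q)) (suc i)           ≡⟨ cong (λ n → f (+ 1 ℤ.+ n) (suc i)) (ℤ.pos-* 2 q) ⟩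
  f (+ 1 ℤ.+ + 2 ℤ.* + q) (suc i)     ≡⟨ f-double+1 i (+ q) ⟩
  f (+ q) i + f (+ (1 + q)) i         ≡⟨ cong₂ _+_ (f≡c[2^i∸m] i q (<⇒≤ q<2^i)) (f≡c[2^i∸m] i (1 + q) q<2^i) ⟩
  c (2 ^ i ∸ q) + c (2 ^ i ∸ suc q)   ≡⟨ cong (λ x → c x + c e) (+-∸-assoc 1 q<2^i) ⟩
  c (1 + e) + c e                     ≡⟨ +-comm (c (1 + e)) (c e) ⟩
  c e + c (1 + e)                     ≡⟨ c-double+1 e ⟨
  c (1 + 2 * e)                       ≡⟨ cong c (2*a∸[1+2*q]≡1+2*[a∸[1+q]] q<2^i) ⟨
  c (2 ^ suc i ∸ (1 + 2 * q))         ∎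
  where
  open ≡-Reasoning
  q<2^i : q ℕ.< 2 ^ i
  q<2^i = *-cancelˡ-< 2 q (2 ^ i) m≤
  e : ℕ
  e = 2 ^ i ∸ suc q

theorem2 : (i : ℕ) (n : ℤ) → + 0 < n → n < + (2 ^ i) →
    f n i ≡ c ∣ + (2 ^ i) - n ∣
theorem2 i (+ m) _ m<2^i = begin
  f (+ m) i                  ≡⟨ f≡c[2^i∸m] i m m≤2^i ⟩
  c (2 ^ i ∸ m)              ≡⟨ cong (c ∘ ∣_∣) (trans (ℤ.m-n≡m⊖n (2 ^ i) m) (ℤ.⊖-≥ m≤2^i)) ⟨
  c ∣ + (2 ^ i) - + m ∣      ∎
  where
  open ≡-Reasoning
  m≤2^i : m ≤ 2 ^ i
  m≤2^i = <⇒≤ (ℤ.drop‿+<+ m<2^i)
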